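{- Let $G$ be a finite simple graph with vertex set $V$, $|V|=n\ge2$, and $e$ edges. Suppose $H$ is a doubly transitive permutation group on $V$ such that the index $|H : H\cap \mathrm{Aut}(G)| = r$. Then $\dfrac{2re}{n(n-1)}\in M(G)$.
   Context: For a positive integer $m$, $mK_n$ denotes the $m$-fold complete multigraph on $n$ vertices, with exactly $m$ parallel edges between each pair of distinct vertices. For a graph $G$ on $n$ vertices, $mK_n$ "can be partitioned into copies of $G$" if there is a finite list of graphs $G_1,\dots,G_l$, each on the same $n$-element vertex set and each isomorphic to $G$, such that every pair of distinct vertices is an edge of exactly $m$ of the $G_i$. Define $M(G)=\{m\in\mathbb{Z}_{>0} : mK_n \text{ can be partitioned into copies of } G\}$. $\mathrm{Aut}(G)$ is the automorphism group of $G$, viewed as a subgroup of the symmetric group on $V$. -}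

module Defs where

open import Data.Nat using (ℕ; zero; suc; _+_; _*_; _∸_; _≤_; _<_)
open import Data.Bool using (Bool; true; false; T; if_then_else_)
open import Data.Fin using (Fin; _<?_)
open import Data.Fin.Permutation using (Permutation′; _⟨$⟩ʳ_; _≈_; _∘ₚ_; flip; id)
open import Data.List using (List; []; _∷_; length; filter; allFin; map)
open import Data.Nat.ListAction using (sum)
import Data.Bool as B
import Data.Bool.ListAction as LA
open import Data.Bool.Properties using (T?)
open import Data.List.Relation.Unary.AllPairs using (AllPairs)
open import Relation.Nullary using (¬_)
open import Data.List.Relation.Unary.Any using (Any)
open import Data.List.Membership.Propositional using (_∈_)
open import Data.Product using (Σ; ∃; _×_; _,_)
open import Relation.Binary.PropositionalEquality using (_≡_; _≢_)
open import Relation.Nullary.Decidable using (⌊_⌋)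

record Graph (n : ℕ) : Set where
  field
    adj   : Fin n → Fin n → Bool
    sym   : ∀ i j → adj i j ≡ adj j i
    irrefl : ∀ i → adj i i ≡ false
open Graph public

edgeCount : ∀ {n} → Graph n → ℕ
edgeCount {n} G =
  sum (map (λ i → sum (map (λ j →
        if ⌊ i <? j ⌋ then (if adj G i j then 1 else 0) else 0)
      (allFin n))) (allFin n))

IsAut : ∀ {n} → Graph n → Permutation′ n → Set
IsAut G σ = ∀ i j → adj G (σ ⟨$⟩ʳ i) (σ ⟨$⟩ʳ j) ≡ adj G i j

isAutB : ∀ {n} → Graph n → Permutation′ n → Bool
isAutB {n} G σ =
  LA.all (λ i → LA.all (λ j → ⌊ adj G (σ ⟨$⟩ʳ i) (σ ⟨$⟩ʳ j) B.≟ adj G i j ⌋) (allFin n)) (allFin n)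

record PermGroup (n : ℕ) : Set where
  field
    elems    : List (Permutation′ n)
    distinct : AllPairs (λ σ τ → ¬ (σ ≈ τ)) elems
    hasId    : Any (λ τ → id ≈ τ) elems
    closed∘  : ∀ {σ τ} → σ ∈ elems → τ ∈ elems → Any (λ ρ → (σ ∘ₚ τ) ≈ ρ) elems
    closed⁻¹ : ∀ {σ} → σ ∈ elems → Any (λ ρ → flip σ ≈ ρ) elems
open PermGroup public

order : ∀ {n} → PermGroup n → ℕ
order H = length (elems H)

orderAutPart : ∀ {n} → PermGroup n → Graph n → ℕ
orderAutPart H G = length (filter (λ σ → T? (isAutB G σ)) (elems H))

DoublyTransitive : ∀ {n} → PermGroup n → Set
DoublyTransitive {n} H = ∀ (a b c d : Fin n) → a ≢ b → c ≢ d →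
  Σ (Permutation′ n) λ σ → σ ∈ elems H × (σ ⟨$⟩ʳ a ≡ c) × (σ ⟨$⟩ʳ b ≡ d)

Isomorphic : ∀ {n} → Graph n → Graph n → Set
Isomorphic {n} G G' = Σ (Permutation′ n) λ σ →
  ∀ i j → adj G' (σ ⟨$⟩ʳ i) (σ ⟨$⟩ʳ j) ≡ adj G i j

multiplicity : ∀ {n} → List (Graph n) → Fin n → Fin n → ℕ
multiplicity Gs i j = length (filter (λ H → T? (adj H i j)) Gs)

-- m K_n can be partitioned into copies of G
Partitionable : ∀ {n} → ℕ → Graph n → Set
Partitionable {n} m G = Σ (List (Graph n)) λ Gs →
  (∀ {G'} → G' ∈ Gs → Isomorphic G G') ×
  (∀ (i j : Fin n) → i ≢ j → multiplicity Gs i j ≡ m)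

InM : ∀ {n} → Graph n → ℕ → Set
InM G m = (0 < m) × Partitionable m G

-- Let a = |H ∩ Aut G|. Each graph σ · G (σ ∈ H) of the H-orbit of G arises from exactly a
-- elements of H, namely a coset of H ∩ Aut G. Hence, for every pair {i,j}, the number of σ ∈ H
-- for which {i,j} is an edge of σ · G is a times the multiplicity of {i,j} in the orbit. By
-- double transitivity that number is the same for all pairs, and counting the incidences
-- (σ, edge of σ · G) in two ways shows it equals |H| · 2e / (n(n-1)) = a · 2re / (n(n-1)).
-- So the orbit covers every pair exactly 2re / (n(n-1)) times.

module Submission where

open import Defs hiding (sym)
open import Algebra.Properties.CommutativeSemigroup using (interchange)
open import Data.Bool using (Bool; true; false; T; if_then_else_)
import Data.Bool as Bool
open import Data.Bool.Properties using (T?; T-∧)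
import Data.Bool.ListAction as Bools
open import Data.Empty using (⊥-elim)
open import Data.Fin using (Fin; zero; suc; _<?_)
open import Data.Fin.Properties as Fin using (all?; ≡-decSetoid; 0≢1+n)
open import Data.Fin.Permutation using (Permutation′; _⟨$⟩ʳ_; _⟨$⟩ˡ_; _≈_; _∘ₚ_; inverseˡ; inverseʳ)
open import Data.List using (List; []; _∷_; length; map; filter; allFin; deduplicate)
open import Data.List.Membership.Propositional using (_∈_; find)
open import Data.List.Membership.Propositional.Properties using (∈-allFin; ∈-map⁻; ∈-length; ∈-deduplicate⁻)
open import Data.List.Properties using (map-∘; length-tabulate; filter-some)
open import Data.List.Relation.Unary.All as All using (All; []; _∷_)
open import Data.List.Relation.Unary.AllPairs using (AllPairs; []; _∷_)
open import Data.List.Relation.Unary.Any as Any using (Any; here; there)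
import Data.List.Relation.Unary.Any.Properties as Any
open import Data.List.Relation.Unary.Unique.Propositional.Properties using (allFin⁺)
import Data.List.Relation.Unary.Unique.DecSetoid as DecSetoidUnique
open import Data.List.Relation.Unary.Unique.DecSetoid.Properties using (deduplicate-!)
open import Data.Nat using (ℕ; suc; _+_; _*_; _∸_; _≤_; _<_; z≤n; s≤s; z<s; >-nonZero)
open import Data.Nat.ListAction using (sum)
open import Data.Nat.Properties using (+-commutativeSemigroup; +-identityʳ; *-zeroʳ; *-suc; *-comm; *-identityʳ; *-identityˡ; *-distribˡ-+; *-cancelˡ-≡; +-cancelʳ-≡; +-comm; *-mono-<; ≮⇒≥)
open import Data.Nat.Solver using (module +-*-Solver)
open import Data.Product using (Σ; _×_; _,_; proj₁; proj₂)
open import Function using (id; _∘_; _⇔_; mk⇔; Equivalence)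
import Function.Properties.Equivalence as ⇔
open import Level using (0ℓ)
open import Relation.Binary using (DecSetoid)
import Relation.Binary.Construct.On as On
open import Relation.Binary.PropositionalEquality
open import Relation.Nullary using (¬_; yes; no)
open import Relation.Nullary.Decidable using (⌊_⌋; does; isYes≗does; toWitness; fromWitness; does-⇔)

𝟙 : Bool → ℕ
𝟙 b = if b then 1 else 0

module _ {A : Set} where

  ∑ : List A → (A → ℕ) → ℕ
  ∑ xs f = sum (map f xs)

  count : (A → Bool) → List A → ℕ
  count q xs = ∑ xs (𝟙 ∘ q)

  ∑-cong : ∀ xs {f g : A → ℕ} → (∀ {x} → x ∈ xs → f x ≡ g x) → ∑ xs f ≡ ∑ xs g
  ∑-cong []       f≡g = refl
  ∑-cong (x ∷ xs) f≡g = cong₂ _+_ (f≡g (here refl)) (∑-cong xs (f≡g ∘ there))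

  ∑-+ : ∀ xs (f g : A → ℕ) → ∑ xs (λ x → f x + g x) ≡ ∑ xs f + ∑ xs g
  ∑-+ []       f g = refl
  ∑-+ (x ∷ xs) f g = trans (cong (f x + g x +_) (∑-+ xs f g))
                           (interchange +-commutativeSemigroup (f x) (g x) (∑ xs f) (∑ xs g))

  ∑-*ˡ : ∀ xs c (f : A → ℕ) → ∑ xs (λ x → c * f x) ≡ c * ∑ xs f
  ∑-*ˡ []       c f = sym (*-zeroʳ c)
  ∑-*ˡ (x ∷ xs) c f = trans (cong (c * f x +_) (∑-*ˡ xs c f)) (sym (*-distribˡ-+ c (f x) (∑ xs f)))

  ∑-const : ∀ xs c → ∑ xs (λ _ → c) ≡ length xs * c
  ∑-const []       c = refl
  ∑-const (x ∷ xs) c = cong (c +_) (∑-const xs c)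

  ∑-if-const : ∀ xs (q : A → Bool) (f : A → ℕ) {v} → (∀ {x} → T (q x) → f x ≡ v) →
               ∑ xs (λ x → if q x then f x else 0) ≡ v * count q xs
  ∑-if-const []       q f {v} f≡v = sym (*-zeroʳ v)
  ∑-if-const (x ∷ xs) q f {v} f≡v with q x in qx
  ... | true  = trans (cong₂ _+_ (f≡v (subst T (sym qx) _)) (∑-if-const xs q f f≡v))
                      (sym (*-suc v (count q xs)))
  ... | false = ∑-if-const xs q f f≡v

  length-filter-T? : ∀ (q : A → Bool) xs → length (filter (T? ∘ q) xs) ≡ count q xs
  length-filter-T? q []       = refl
  length-filter-T? q (x ∷ xs) with q x
  ... | true  = cong suc (length-filter-T? q xs)
  ... | false = length-filter-T? q xs

  count-unique : ∀ (R : A → A → Set) (q : A → Bool) {xs} → AllPairs (λ x y → ¬ R x y) xs →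
                 Any (T ∘ q) xs → (∀ {x y} → T (q x) → T (q y) → R x y) → count q xs ≡ 1
  count-unique R q {x ∷ xs} (x≉xs ∷ xs!) ∃q q⇒R with q x in qx
  ... | true  = cong suc (count-none xs x≉xs)
    where
    count-none : ∀ ys → All (λ y → ¬ R x y) ys → count q ys ≡ 0
    count-none []       []           = refl
    count-none (y ∷ ys) (x≉y ∷ x≉ys) with q y in qy
    ... | true  = ⊥-elim (x≉y (q⇒R (subst T (sym qx) _) (subst T (sym qy) _)))
    ... | false = count-none ys x≉ys
  ... | false with ∃q
  ...   | here qx′   = ⊥-elim (subst T qx qx′)
  ...   | there ∃q′ = count-unique R q xs! ∃q′ q⇒R

∑-comm : ∀ {A B : Set} xs ys (f : A → B → ℕ) →
         ∑ xs (λ x → ∑ ys (f x)) ≡ ∑ ys (λ y → ∑ xs (λ x → f x y))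
∑-comm []       ys f = sym (trans (∑-const ys 0) (*-zeroʳ (length ys)))
∑-comm (x ∷ xs) ys f = trans (cong (∑ ys (f x) +_) (∑-comm xs ys f))
                             (sym (∑-+ ys (f x) (λ y → ∑ xs (λ x → f x y))))

∑-map : ∀ {A B : Set} (g : A → B) xs (f : B → ℕ) → ∑ (map g xs) f ≡ ∑ xs (f ∘ g)
∑-map g xs f = cong sum (sym (map-∘ xs))

module _ (S : DecSetoid 0ℓ 0ℓ) where
  open DecSetoid S using (_≟_) renaming (Carrier to A; _≈_ to _≈ₛ_; sym to ≈-sym; trans to ≈-trans)
  open DecSetoidUnique S using (Unique)

  ∑-pick : ∀ {D x} (f : A → ℕ) → Unique D → Any (_≈ₛ x) D → (∀ {y z} → y ≈ₛ z → f y ≡ f z) →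
           ∑ D (λ d → if ⌊ d ≟ x ⌋ then f d else 0) ≡ f x
  ∑-pick {D} {x} f D! x∈D f-resp = begin
      ∑ D (λ d → if ⌊ d ≟ x ⌋ then f d else 0)
    ≡⟨ ∑-if-const D _ f (f-resp ∘ toWitness) ⟩
      f x * count (λ d → ⌊ d ≟ x ⌋) D
    ≡⟨ cong (f x *_) (count-unique _≈ₛ_ _ D! (Any.map fromWitness x∈D)
                       (λ d≈x d′≈x → ≈-trans (toWitness d≈x) (≈-sym (toWitness d′≈x)))) ⟩
      f x * 1
    ≡⟨ *-identityʳ (f x) ⟩
      f x
    ∎
    where open ≡-Reasoning

  ∑-classes : ∀ {xs D a} (f : A → ℕ) → Unique D → (∀ {x} → x ∈ xs → Any (_≈ₛ x) D) →
              (∀ {d} → d ∈ D → count (λ x → ⌊ d ≟ x ⌋) xs ≡ a) →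
              (∀ {x y} → x ≈ₛ y → f x ≡ f y) → ∑ xs f ≡ a * ∑ D f
  ∑-classes {xs} {D} {a} f D! cover classSize f-resp = begin
      ∑ xs f
    ≡⟨ ∑-cong xs (λ x∈ → sym (∑-pick f D! (cover x∈) f-resp)) ⟩
      ∑ xs (λ x → ∑ D (λ d → if ⌊ d ≟ x ⌋ then f d else 0))
    ≡⟨ ∑-comm xs D _ ⟩
      ∑ D (λ d → ∑ xs (λ x → if ⌊ d ≟ x ⌋ then f d else 0))
    ≡⟨ ∑-cong D (λ {d} d∈ → trans (∑-if-const xs _ (λ _ → f d) (λ _ → refl)) (cong (f d *_) (classSize d∈))) ⟩
      ∑ D (λ d → f d * a)
    ≡⟨ ∑-cong D (λ {d} _ → *-comm (f d) a) ⟩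
      ∑ D (λ d → a * f d)
    ≡⟨ ∑-*ˡ D a f ⟩
      a * ∑ D f
    ∎
    where open ≡-Reasoning

  ∑-bijection : ∀ {xs} (g : A → A) (f : A → ℕ) → Unique xs →
                (∀ {x} → x ∈ xs → Any (_≈ₛ g x) xs) →
                (∀ {y} → y ∈ xs → Any (λ x → y ≈ₛ g x) xs) →
                (∀ {x y} → g x ≈ₛ g y → x ≈ₛ y) →
                (∀ {x y} → x ≈ₛ y → f x ≡ f y) → ∑ xs (f ∘ g) ≡ ∑ xs f
  ∑-bijection {xs} g f xs! into onto g-injective f-resp = begin
      ∑ xs (f ∘ g)    ≡⟨ ∑-map g xs f ⟨
      ∑ (map g xs) f  ≡⟨ ∑-classes f xs! imageCover fibre f-resp ⟩
      1 * ∑ xs f      ≡⟨ *-identityˡ (∑ xs f) ⟩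
      ∑ xs f          ∎
    where
    open ≡-Reasoning
    imageCover : ∀ {z} → z ∈ map g xs → Any (_≈ₛ z) xs
    imageCover z∈ with ∈-map⁻ g z∈
    ... | x , x∈ , refl = into x∈
    fibre : ∀ {y} → y ∈ xs → count (λ z → ⌊ y ≟ z ⌋) (map g xs) ≡ 1
    fibre y∈ = trans (∑-map g xs _)
      (count-unique _≈ₛ_ _ xs! (Any.map fromWitness (onto y∈))
        (λ y≈gx y≈gx′ → g-injective (≈-trans (≈-sym (toWitness y≈gx)) (toWitness y≈gx′))))

  ≟-respʳ : ∀ x {y z} → y ≈ₛ z → ⌊ x ≟ y ⌋ ≡ ⌊ x ≟ z ⌋
  ≟-respʳ x {y} {z} y≈z = begin
      ⌊ x ≟ y ⌋     ≡⟨ isYes≗does (x ≟ y) ⟩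
      does (x ≟ y)  ≡⟨ does-⇔ (mk⇔ (λ x≈y → ≈-trans x≈y y≈z) (λ x≈z → ≈-trans x≈z (≈-sym y≈z))) (x ≟ y) (x ≟ z) ⟩
      does (x ≟ z)  ≡⟨ isYes≗does (x ≟ z) ⟨
      ⌊ x ≟ z ⌋     ∎
    where open ≡-Reasoning

T-all⇔ : ∀ {A : Set} (p : A → Bool) xs → T (Bools.all p xs) ⇔ All (T ∘ p) xs
T-all⇔ p []       = mk⇔ (λ _ → []) (λ _ → _)
T-all⇔ p (x ∷ xs) = mk⇔
  (λ t → let px , pxs = Equivalence.to T-∧ t in px ∷ Equivalence.to (T-all⇔ p xs) pxs)
  (λ { (px ∷ pxs) → Equivalence.from T-∧ (px , Equivalence.from (T-all⇔ p xs) pxs) })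

T-allFin⇔ : ∀ {n} (p : Fin n → Bool) → T (Bools.all p (allFin n)) ⇔ (∀ i → T (p i))
T-allFin⇔ {n} p = mk⇔
  (λ t i → All.lookup (Equivalence.to (T-all⇔ p (allFin n)) t) (∈-allFin i))
  (λ ∀p → Equivalence.from (T-all⇔ p (allFin n)) (All.tabulate (λ {i} _ → ∀p i)))

∑-allFin-const : ∀ n c → ∑ (allFin n) (λ _ → c) ≡ n * c
∑-allFin-const n c = trans (∑-const (allFin n) c) (cong (_* c) (length-tabulate {n = n} id))

∑-permute : ∀ {n} (π : Permutation′ n) (h : Fin n → ℕ) →
            ∑ (allFin n) (h ∘ (π ⟨$⟩ˡ_)) ≡ ∑ (allFin n) h
∑-permute {n} π h = ∑-bijection (≡-decSetoid n) (π ⟨$⟩ˡ_) h (allFin⁺ n)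
  (λ {i} _ → Any.map sym (∈-allFin (π ⟨$⟩ˡ i)))
  (λ {j} _ → Any.map (λ { refl → sym (inverseˡ π) }) (∈-allFin (π ⟨$⟩ʳ j)))
  (λ π⁻¹i≡π⁻¹j → trans (sym (inverseʳ π)) (trans (cong (π ⟨$⟩ʳ_) π⁻¹i≡π⁻¹j) (inverseʳ π)))
  (cong h)

≈ₚ-decSetoid : ℕ → DecSetoid 0ℓ 0ℓ
≈ₚ-decSetoid n = record
  { Carrier          = Permutation′ n
  ; _≈_              = _≈_
  ; isDecEquivalence = record
    { isEquivalence = record
      { refl  = λ _ → refl
      ; sym   = λ π≈ρ i → sym (π≈ρ i)
      ; trans = λ π≈ρ ρ≈σ i → trans (π≈ρ i) (ρ≈σ i)
      }
    ; _≟_ = λ π ρ → all? (λ i → π ⟨$⟩ʳ i Fin.≟ ρ ⟨$⟩ʳ i)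
    }
  }

⟨$⟩ˡ-cong : ∀ {n} (π ρ : Permutation′ n) → π ≈ ρ → ∀ i → π ⟨$⟩ˡ i ≡ ρ ⟨$⟩ˡ i
⟨$⟩ˡ-cong π ρ π≈ρ i = begin
    π ⟨$⟩ˡ i                       ≡⟨ inverseˡ ρ ⟨
    ρ ⟨$⟩ˡ (ρ ⟨$⟩ʳ (π ⟨$⟩ˡ i))      ≡⟨ cong (ρ ⟨$⟩ˡ_) (π≈ρ (π ⟨$⟩ˡ i)) ⟨
    ρ ⟨$⟩ˡ (π ⟨$⟩ʳ (π ⟨$⟩ˡ i))      ≡⟨ cong (ρ ⟨$⟩ˡ_) (inverseʳ π) ⟩
    ρ ⟨$⟩ˡ i                       ∎
  where open ≡-Reasoning

module _ {n : ℕ} where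

  infixr 6 _·_
  _·_ : Permutation′ n → Graph n → Graph n
  π · G = record
    { adj    = λ i j → adj G (π ⟨$⟩ˡ i) (π ⟨$⟩ˡ j)
    ; sym    = λ i j → Graph.sym G (π ⟨$⟩ˡ i) (π ⟨$⟩ˡ j)
    ; irrefl = λ i → irrefl G (π ⟨$⟩ˡ i)
    }

  isomorphic-· : ∀ π G → Isomorphic G (π · G)
  isomorphic-· π G = π , λ i j → cong₂ (adj G) (inverseˡ π) (inverseˡ π)

  infix 4 _≐_
  _≐_ : Graph n → Graph n → Set
  G₁ ≐ G₂ = ∀ i j → adj G₁ i j ≡ adj G₂ i j

  ·-cong : ∀ G π ρ → π ≈ ρ → π · G ≐ ρ · G
  ·-cong G π ρ π≈ρ i j = cong₂ (adj G) (⟨$⟩ˡ-cong π ρ π≈ρ i) (⟨$⟩ˡ-cong π ρ π≈ρ j)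

  ·-cancel : ∀ π {G₁ G₂} → π · G₁ ≐ π · G₂ → G₁ ≐ G₂
  ·-cancel π {G₁} {G₂} πG₁≐πG₂ i j = begin
      adj G₁ i j                                   ≡⟨ cong₂ (adj G₁) (inverseˡ π) (inverseˡ π) ⟨
      adj G₁ (π ⟨$⟩ˡ (π ⟨$⟩ʳ i)) (π ⟨$⟩ˡ (π ⟨$⟩ʳ j)) ≡⟨ πG₁≐πG₂ (π ⟨$⟩ʳ i) (π ⟨$⟩ʳ j) ⟩
      adj G₂ (π ⟨$⟩ˡ (π ⟨$⟩ʳ i)) (π ⟨$⟩ˡ (π ⟨$⟩ʳ j)) ≡⟨ cong₂ (adj G₂) (inverseˡ π) (inverseˡ π) ⟩
      adj G₂ i j                                   ∎
    where open ≡-Reasoning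

  -- (τ ∘ₚ σ) · G is σ · (τ · G) on the nose, so σ cancels
  ·≐∘ₚ·⇔IsAut : ∀ G σ τ → σ · G ≐ (τ ∘ₚ σ) · G ⇔ IsAut G τ
  ·≐∘ₚ·⇔IsAut G σ τ = mk⇔
    (λ σG≐τσG i j → trans (·-cancel σ {G} {τ · G} σG≐τσG (τ ⟨$⟩ʳ i) (τ ⟨$⟩ʳ j))
                          (cong₂ (adj G) (inverseˡ τ) (inverseˡ τ)))
    (λ aut i j → trans (sym (cong₂ (adj G) (inverseʳ τ) (inverseʳ τ)))
                       (aut (τ ⟨$⟩ˡ (σ ⟨$⟩ˡ i)) (τ ⟨$⟩ˡ (σ ⟨$⟩ˡ j))))

  T-isAutB⇔IsAut : ∀ G τ → T (isAutB G τ) ⇔ IsAut G τ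
  T-isAutB⇔IsAut G τ = mk⇔
    (λ t i j → toWitness (Equivalence.to (T-allFin⇔ (agree i)) (Equivalence.to (T-allFin⇔ row) t i) j))
    (λ aut → Equivalence.from (T-allFin⇔ row) λ i →
             Equivalence.from (T-allFin⇔ (agree i)) λ j → fromWitness (aut i j))
    where
    agree : Fin n → Fin n → Bool
    agree i j = ⌊ adj G (τ ⟨$⟩ʳ i) (τ ⟨$⟩ʳ j) Bool.≟ adj G i j ⌋
    row : Fin n → Bool
    row i = Bools.all (agree i) (allFin n)

≐-decSetoid : ℕ → DecSetoid 0ℓ 0ℓ
≐-decSetoid n = record
  { Carrier          = Graph n
  ; _≈_              = _≐_
  ; isDecEquivalence = record
    { isEquivalence = record
      { refl  = λ _ _ → refl
      ; sym   = λ G₁≐G₂ i j → sym (G₁≐G₂ i j)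
      ; trans = λ G₁≐G₂ G₂≐G₃ i j → trans (G₁≐G₂ i j) (G₂≐G₃ i j)
      }
    ; _≟_ = λ G₁ G₂ → all? (λ i → all? (λ j → adj G₁ i j Bool.≟ adj G₂ i j))
    }
  }

adjacencySum : ∀ {n} → Graph n → ℕ
adjacencySum {n} G = ∑ (allFin n) λ i → ∑ (allFin n) λ j → 𝟙 (adj G i j)

adjacencySum-· : ∀ {n} (π : Permutation′ n) G → adjacencySum (π · G) ≡ adjacencySum G
adjacencySum-· {n} π G = begin
    ∑ F (λ i → ∑ F (λ j → 𝟙 (adj G (π ⟨$⟩ˡ i) (π ⟨$⟩ˡ j))))
  ≡⟨ ∑-cong F (λ {i} _ → ∑-permute π (λ j → 𝟙 (adj G (π ⟨$⟩ˡ i) j))) ⟩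
    ∑ F (λ i → ∑ F (λ j → 𝟙 (adj G (π ⟨$⟩ˡ i) j)))
  ≡⟨ ∑-permute π (λ i → ∑ F (λ j → 𝟙 (adj G i j))) ⟩
    adjacencySum G
  ∎
  where
  open ≡-Reasoning
  F = allFin n

adjacencySum≡2*edgeCount : ∀ {n} (G : Graph n) → adjacencySum G ≡ 2 * edgeCount G
adjacencySum≡2*edgeCount {n} G = begin
    adjacencySum G
  ≡⟨ ∑-cong F (λ {i} _ → trans (∑-cong F (λ {j} _ → split i j)) (∑-+ F (upper i) (λ j → upper j i))) ⟩
    ∑ F (λ i → ∑ F (upper i) + ∑ F (λ j → upper j i))
  ≡⟨ ∑-+ F _ _ ⟩
    edgeCount G + ∑ F (λ i → ∑ F (λ j → upper j i))
  ≡⟨ cong (edgeCount G +_) (∑-comm F F (λ i j → upper j i)) ⟩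
    edgeCount G + edgeCount G
  ≡⟨ cong (edgeCount G +_) (+-identityʳ (edgeCount G)) ⟨
    2 * edgeCount G
  ∎
  where
  open ≡-Reasoning
  F = allFin n
  upper : Fin n → Fin n → ℕ
  upper i j = if ⌊ i <? j ⌋ then 𝟙 (adj G i j) else 0
  split : ∀ i j → 𝟙 (adj G i j) ≡ upper i j + upper j i
  split i j with i <? j | j <? i
  ... | yes i<j | yes j<i = ⊥-elim (Fin.<-asym i<j j<i)
  ... | yes _   | no _    = sym (+-identityʳ _)
  ... | no _    | yes _   = cong 𝟙 (Graph.sym G i j)
  ... | no i≮j  | no j≮i  with refl ← Fin.≤-antisym (≮⇒≥ j≮i) (≮⇒≥ i≮j) = cong 𝟙 (irrefl G i)

module _ {n : ℕ} (H : PermGroup n) where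

  rightDivide : ∀ {σ ρ} → σ ∈ elems H → ρ ∈ elems H → Any (λ τ → σ ≈ τ ∘ₚ ρ) (elems H)
  rightDivide {σ} {ρ} σ∈ ρ∈ with find (closed⁻¹ H ρ∈)
  ... | ρ′ , ρ′∈ , ρ⁻¹≈ρ′ = Any.map (λ {τ} σρ′≈τ i → begin
          σ ⟨$⟩ʳ i                    ≡⟨ inverseʳ ρ ⟨
          ρ ⟨$⟩ʳ (ρ ⟨$⟩ˡ (σ ⟨$⟩ʳ i))   ≡⟨ cong (ρ ⟨$⟩ʳ_) (ρ⁻¹≈ρ′ (σ ⟨$⟩ʳ i)) ⟩
          ρ ⟨$⟩ʳ (ρ′ ⟨$⟩ʳ (σ ⟨$⟩ʳ i))  ≡⟨ cong (ρ ⟨$⟩ʳ_) (σρ′≈τ i) ⟩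
          ρ ⟨$⟩ʳ (τ ⟨$⟩ʳ i)           ∎)
        (closed∘ H σ∈ ρ′∈)
    where open ≡-Reasoning

  ∑-∘ₚ-invariant : ∀ {ρ} → ρ ∈ elems H → (f : Permutation′ n → ℕ) → (∀ {σ τ} → σ ≈ τ → f σ ≡ f τ) →
                   ∑ (elems H) (λ τ → f (τ ∘ₚ ρ)) ≡ ∑ (elems H) f
  ∑-∘ₚ-invariant {ρ} ρ∈ f f-resp = ∑-bijection (≈ₚ-decSetoid n) (_∘ₚ ρ) f (distinct H)
    (λ τ∈ → Any.map (λ τρ≈σ i → sym (τρ≈σ i)) (closed∘ H τ∈ ρ∈))
    (λ σ∈ → rightDivide σ∈ ρ∈)
    (λ τρ≈τ′ρ i → trans (sym (inverseˡ ρ)) (trans (cong (ρ ⟨$⟩ˡ_) (τρ≈τ′ρ i)) (inverseˡ ρ)))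
    f-resp

  order-pos : 0 < order H
  order-pos = ∈-length (proj₁ (proj₂ (find (hasId H))))

  orderAutPart-pos : ∀ G → 0 < orderAutPart H G
  orderAutPart-pos G = filter-some (T? ∘ isAutB G)
    (Any.map (λ {ι} id≈ι → Equivalence.from (T-isAutB⇔IsAut G ι)
                             (λ i j → cong₂ (adj G) (sym (id≈ι i)) (sym (id≈ι j))))
             (hasId H))

module Orbit {n : ℕ} (G : Graph n) (H : PermGroup n) where

  sameImage : DecSetoid 0ℓ 0ℓ
  sameImage = On.decSetoid (≐-decSetoid n) (_· G)

  open DecSetoid sameImage using () renaming (_≟_ to _≟ᵢ_)

  orbit : List (Permutation′ n)
  orbit = deduplicate _≟ᵢ_ (elems H)

  orbitGraphs : List (Graph n)
  orbitGraphs = map (_· G) orbit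

  isomorphic-orbitGraphs : ∀ {G′} → G′ ∈ orbitGraphs → Isomorphic G G′
  isomorphic-orbitGraphs G′∈ with ∈-map⁻ (_· G) G′∈
  ... | σ , _ , refl = isomorphic-· σ G

  count-sameImage : ∀ {y} → y ∈ elems H → count (λ τ → ⌊ y ≟ᵢ τ ⌋) (elems H) ≡ orderAutPart H G
  count-sameImage {y} y∈ = begin
      count (λ τ → ⌊ y ≟ᵢ τ ⌋) (elems H)
    ≡⟨ ∑-∘ₚ-invariant H y∈ (λ τ → 𝟙 ⌊ y ≟ᵢ τ ⌋) (λ {σ} {τ} σ≈τ → cong 𝟙 (≟-respʳ sameImage y {σ} {τ} (·-cong G σ τ σ≈τ))) ⟨
      ∑ (elems H) (λ τ → 𝟙 ⌊ y ≟ᵢ τ ∘ₚ y ⌋)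
    ≡⟨ ∑-cong (elems H) (λ {τ} _ → cong 𝟙 (trans (isYes≗does (y ≟ᵢ τ ∘ₚ y))
        (does-⇔ (⇔.trans (·≐∘ₚ·⇔IsAut G y τ) (⇔.sym (T-isAutB⇔IsAut G τ))) (y ≟ᵢ τ ∘ₚ y) (T? (isAutB G τ))))) ⟩
      count (isAutB G) (elems H)
    ≡⟨ length-filter-T? (isAutB G) (elems H) ⟨
      orderAutPart H G
    ∎
    where open ≡-Reasoning

  count-orbit : (p : Permutation′ n → Bool) → (∀ {σ τ} → σ · G ≐ τ · G → p σ ≡ p τ) →
                count p (elems H) ≡ orderAutPart H G * count p orbit
  count-orbit p p-resp = ∑-classes sameImage (𝟙 ∘ p) (deduplicate-! sameImage (elems H)) cover
    (count-sameImage ∘ ∈-deduplicate⁻ _≟ᵢ_ (elems H)) (cong 𝟙 ∘ p-resp)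
    where
    cover : ∀ {x} → x ∈ elems H → Any (λ d → d · G ≐ x · G) orbit
    cover = Any.deduplicate⁺ _≟ᵢ_ (λ b≐a a≐x i j → trans (b≐a i j) (a≐x i j))
          ∘ Any.map (λ { refl _ _ → refl })

  timesCovered : Fin n → Fin n → ℕ
  timesCovered i j = count (λ σ → adj (σ · G) i j) (elems H)

  timesCovered≡*multiplicity : ∀ i j →
    timesCovered i j ≡ orderAutPart H G * multiplicity orbitGraphs i j
  timesCovered≡*multiplicity i j = begin
      timesCovered i j
    ≡⟨ count-orbit (λ σ → adj (σ · G) i j) (λ σG≐τG → σG≐τG i j) ⟩
      orderAutPart H G * count (λ σ → adj (σ · G) i j) orbit
    ≡⟨ cong (orderAutPart H G *_) (∑-map (_· G) orbit (λ G′ → 𝟙 (adj G′ i j))) ⟨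
      orderAutPart H G * count (λ G′ → adj G′ i j) orbitGraphs
    ≡⟨ cong (orderAutPart H G *_) (length-filter-T? (λ G′ → adj G′ i j) orbitGraphs) ⟨
      orderAutPart H G * multiplicity orbitGraphs i j
    ∎
    where open ≡-Reasoning

  timesCovered-diag : ∀ i → timesCovered i i ≡ 0
  timesCovered-diag i = begin
      timesCovered i i            ≡⟨ ∑-cong (elems H) (λ {σ} _ → cong 𝟙 (irrefl (σ · G) i)) ⟩
      ∑ (elems H) (λ _ → 0)       ≡⟨ ∑-const (elems H) 0 ⟩
      order H * 0                 ≡⟨ *-zeroʳ (order H) ⟩
      0                           ∎
    where open ≡-Reasoning

  timesCovered-offDiag : DoublyTransitive H → ∀ {i j k l} → i ≢ j → k ≢ l →
                         timesCovered k l ≡ timesCovered i j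
  timesCovered-offDiag dt {i} {j} {k} {l} i≢j k≢l with dt i j k l i≢j k≢l
  ... | τ , τ∈ , τi≡k , τj≡l = begin
      timesCovered k l
    ≡⟨ ∑-∘ₚ-invariant H τ∈ (λ σ → 𝟙 (adj (σ · G) k l))
                         (λ {σ} {σ′} σ≈σ′ → cong 𝟙 (·-cong G σ σ′ σ≈σ′ k l)) ⟨
      ∑ (elems H) (λ σ → 𝟙 (adj (σ · G) (τ ⟨$⟩ˡ k) (τ ⟨$⟩ˡ l)))
    ≡⟨ ∑-cong (elems H) (λ {σ} _ → cong 𝟙 (cong₂ (adj (σ · G)) (preimage τi≡k) (preimage τj≡l))) ⟩
      timesCovered i j
    ∎
    where
    open ≡-Reasoning
    preimage : ∀ {u v} → τ ⟨$⟩ʳ u ≡ v → τ ⟨$⟩ˡ v ≡ u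
    preimage refl = inverseˡ τ

  ∑-timesCovered-row : ∀ {c} → (∀ {i j} → i ≢ j → timesCovered i j ≡ c) →
                       ∀ i → ∑ (allFin n) (timesCovered i) ≡ (n ∸ 1) * c
  ∑-timesCovered-row {c} offDiag i = +-cancelʳ-≡ c _ _ (begin
      ∑ F (timesCovered i) + c
    ≡⟨ cong (∑ F (timesCovered i) +_) (∑-pick (≡-decSetoid n) (λ _ → c) (allFin⁺ n)
                                         (Any.map sym (∈-allFin i)) (λ _ → refl)) ⟨
      ∑ F (timesCovered i) + ∑ F (λ j → if ⌊ j Fin.≟ i ⌋ then c else 0)
    ≡⟨ ∑-+ F (timesCovered i) _ ⟨
      ∑ F (λ j → timesCovered i j + (if ⌊ j Fin.≟ i ⌋ then c else 0))
    ≡⟨ ∑-cong F (λ {j} _ → entry j) ⟩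
      ∑ F (λ _ → c)
    ≡⟨ ∑-allFin-const n c ⟩
      n * c
    ≡⟨ *-pred i ⟩
      (n ∸ 1) * c + c
    ∎)
    where
    open ≡-Reasoning
    F = allFin n
    *-pred : ∀ {m} → Fin m → m * c ≡ (m ∸ 1) * c + c
    *-pred {suc m} _ = +-comm c (m * c)
    entry : ∀ j → timesCovered i j + (if ⌊ j Fin.≟ i ⌋ then c else 0) ≡ c
    entry j with j Fin.≟ i
    ... | yes refl = cong (_+ c) (timesCovered-diag i)
    ... | no j≢i   = trans (+-identityʳ _) (offDiag (j≢i ∘ sym))

  ∑-timesCovered : ∑ (allFin n) (λ i → ∑ (allFin n) (timesCovered i)) ≡ order H * adjacencySum G
  ∑-timesCovered = begin
      ∑ F (λ i → ∑ F (λ j → ∑ L (λ σ → 𝟙 (adj (σ · G) i j))))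
    ≡⟨ ∑-cong F (λ {i} _ → ∑-comm F L (λ j σ → 𝟙 (adj (σ · G) i j))) ⟩
      ∑ F (λ i → ∑ L (λ σ → ∑ F (λ j → 𝟙 (adj (σ · G) i j))))
    ≡⟨ ∑-comm F L _ ⟩
      ∑ L (λ σ → adjacencySum (σ · G))
    ≡⟨ ∑-cong L (λ {σ} _ → adjacencySum-· σ G) ⟩
      ∑ L (λ _ → adjacencySum G)
    ≡⟨ ∑-const L (adjacencySum G) ⟩
      order H * adjacencySum G
    ∎
    where
    open ≡-Reasoning
    F = allFin n
    L = elems H

  timesCovered-doubleCount : DoublyTransitive H → ∀ {i j} → i ≢ j →
                             n * ((n ∸ 1) * timesCovered i j) ≡ order H * (2 * edgeCount G)
  timesCovered-doubleCount dt {i} {j} i≢j = begin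
      n * ((n ∸ 1) * timesCovered i j)
    ≡⟨ ∑-allFin-const n _ ⟨
      ∑ F (λ _ → (n ∸ 1) * timesCovered i j)
    ≡⟨ ∑-cong F (λ {k} _ → ∑-timesCovered-row (timesCovered-offDiag dt i≢j) k) ⟨
      ∑ F (λ k → ∑ F (timesCovered k))
    ≡⟨ ∑-timesCovered ⟩
      order H * adjacencySum G
    ≡⟨ cong (order H *_) (adjacencySum≡2*edgeCount G) ⟩
      order H * (2 * edgeCount G)
    ∎
    where
    open ≡-Reasoning
    F = allFin n

  multiplicity-offDiag : DoublyTransitive H → ∀ {i j k l} → i ≢ j → k ≢ l →
                         multiplicity orbitGraphs k l ≡ multiplicity orbitGraphs i j
  multiplicity-offDiag dt {i} {j} {k} {l} i≢j k≢l =
    *-cancelˡ-≡ _ _ (orderAutPart H G) {{>-nonZero (orderAutPart-pos H G)}} (begin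
      orderAutPart H G * multiplicity orbitGraphs k l  ≡⟨ timesCovered≡*multiplicity k l ⟨
      timesCovered k l                                 ≡⟨ timesCovered-offDiag dt i≢j k≢l ⟩
      timesCovered i j                                 ≡⟨ timesCovered≡*multiplicity i j ⟩
      orderAutPart H G * multiplicity orbitGraphs i j  ∎)
    where open ≡-Reasoning

  multiplicity-doubleCount : DoublyTransitive H → ∀ {i j} → i ≢ j →
    orderAutPart H G * (multiplicity orbitGraphs i j * (n * (n ∸ 1))) ≡ order H * (2 * edgeCount G)
  multiplicity-doubleCount dt {i} {j} i≢j = begin
      a * (μ * (n * (n ∸ 1)))           ≡⟨ solve 4 (λ a μ n s → a :* (μ :* (n :* s)) := n :* (s :* (a :* μ)))
                                                  refl a μ n (n ∸ 1) ⟩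
      n * ((n ∸ 1) * (a * μ))           ≡⟨ cong (λ x → n * ((n ∸ 1) * x)) (timesCovered≡*multiplicity i j) ⟨
      n * ((n ∸ 1) * timesCovered i j)  ≡⟨ timesCovered-doubleCount dt i≢j ⟩
      order H * (2 * edgeCount G)       ∎
    where
    open ≡-Reasoning
    open +-*-Solver
    a = orderAutPart H G
    μ = multiplicity orbitGraphs i j

m*n>0⇒m>0 : ∀ m {n} → 0 < m * n → 0 < m
m*n>0⇒m>0 (suc m) _ = z<s

proposition2 : (n : ℕ) → 2 ≤ n → (G : Graph n) → 0 < edgeCount G →
    (H : PermGroup n) → DoublyTransitive H → (r : ℕ) →
    order H ≡ r * orderAutPart H G →
    Σ ℕ λ m → (m * (n * (n ∸ 1)) ≡ 2 * r * edgeCount G) × InM G m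
proposition2 n@(suc (suc _)) (s≤s (s≤s z≤n)) G e>0 H dt r |H|≡ra =
  m , m*n[n-1]≡2re , m>0 , orbitGraphs , isomorphic-orbitGraphs ,
  λ i j i≢j → multiplicity-offDiag dt 0≢1+n i≢j
  where
  open Orbit G H
  open ≡-Reasoning
  open +-*-Solver
  a = orderAutPart H G
  e = edgeCount G
  m = multiplicity orbitGraphs zero (suc zero)
  m*n[n-1]≡2re : m * (n * (n ∸ 1)) ≡ 2 * r * e
  m*n[n-1]≡2re = *-cancelˡ-≡ _ _ a {{>-nonZero (orderAutPart-pos H G)}} (begin
      a * (m * (n * (n ∸ 1)))  ≡⟨ multiplicity-doubleCount dt 0≢1+n ⟩
      order H * (2 * e)        ≡⟨ cong (_* (2 * e)) |H|≡ra ⟩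
      r * a * (2 * e)          ≡⟨ solve 3 (λ r a e → r :* a :* (con 2 :* e) := a :* (con 2 :* r :* e)) refl r a e ⟩
      a * (2 * r * e)          ∎)
  r>0 : 0 < r
  r>0 = m*n>0⇒m>0 r {a} (subst (0 <_) |H|≡ra (order-pos H))
  m>0 : 0 < m
  m>0 = m*n>0⇒m>0 m (subst (0 <_) (sym m*n[n-1]≡2re) (*-mono-< (*-mono-< (z<s {n = 1}) r>0) e>0))
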